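{- Let $\mathcal{A}$ be an alphabet with $b$ symbols, let $k,j$ be positive integers and let $N=[u]$ be a $(k,j)$-perfect necklace. If $n$ is a positive integer with $d_{b,n}\mid j\mid n$, then the necklace of length $nb^k$ obtained by concatenating $u$ with itself $n/j$ times is $(k,n)$-perfect.
   Context: A necklace is the equivalence class of a word under cyclic rotations; a word $w$ of length $k$ occurs in $[s]$ ($|s|=M$) at position $i$ if $s((i+t)\bmod M)=w(t)$ for $0\le t<k$. A necklace is $(k,n)$-perfect if it has length $n|\mathcal{A}|^k$ and each word of length $k$ occurs in it exactly $n$ times at positions pairwise different modulo $n$. For positive integers $m,n$, $d_{m,n}=\prod_i p_i^{\alpha_i}$, where $\{p_i\}$ is the set of primes dividing $m$ and $\alpha_i$ is the exponent of $p_i$ in the prime factorization of $n$. -}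

module Defs where

open import Data.Nat using (ℕ; zero; suc; _+_; _*_; _^_; _≤_; NonZero)
open import Data.Nat.DivMod using (_mod_; _/_; _%_)
open import Data.Nat.Divisibility using (_∣?_)
open import Data.Nat.Primality using (prime?)
open import Data.Fin using (Fin; toℕ)
open import Data.List using (List; length; lookup; upTo; map; filterᵇ)
open import Data.Nat.ListAction using (product)
open import Data.Product using (Σ; _×_)
open import Relation.Nullary.Decidable using (does; _×-dec_)
open import Relation.Binary.PropositionalEquality using (_≡_)
open import Data.Bool using (if_then_else_)

shift : (L : ℕ) → Fin L → ℕ → Fin L
shift (suc m) i t = (toℕ i + t) mod (suc m)

OccursAt : {A : Set} → List A → (s : List A) → Fin (length s) → Set
OccursAt w s i = (t : Fin (length w)) → lookup s (shift (length s) i (toℕ t)) ≡ lookup w t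

-- [s] is (k,n)-perfect over the alphabet Fin b:
--   |s| = n b^k, and every word w of length k occurs exactly n times, at
--   positions pairwise different modulo n.  "Exactly n times at positions
--   pairwise different mod n" is expressed by an enumeration f : Fin n → positions
--   whose image is exactly the set of occurrence positions and which is
--   injective modulo n (hence injective, so there are exactly n occurrences).
Perfect : (b k n : ℕ) .{{_ : NonZero n}} → List (Fin b) → Set
Perfect b k n s =
  (length s ≡ n * b ^ k) ×
  ((w : List (Fin b)) → length w ≡ k →
     Σ (Fin n → Fin (length s)) λ f →
       ((a : Fin n) → OccursAt w s (f a)) ×
       ((i : Fin (length s)) → OccursAt w s i → Σ (Fin n) λ a → f a ≡ i) ×
       ((a a' : Fin n) → toℕ (f a) % n ≡ toℕ (f a') % n → a ≡ a'))

-- exponent of p in the prime factorisation of n (fuel-bounded; fuel n suffices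
-- for p ≥ 2, n ≥ 1)
valFuel : ℕ → ℕ → ℕ → ℕ
valFuel zero p n = 0
valFuel (suc f) zero n = 0
valFuel (suc f) (suc q) zero = 0
valFuel (suc f) (suc q) (suc n) =
  if does (suc q ∣? suc n) then suc (valFuel f (suc q) (suc n / suc q)) else 0

val : ℕ → ℕ → ℕ
val p n = valFuel n p n

-- d_{m,n} = ∏ p^{α_p}, p ranging over primes dividing m, α_p the exponent of p
-- in n.  Only primes p ≤ n can have α_p > 0, so the product is taken over the
-- primes p ≤ n dividing m (other factors are 1).
d : ℕ → ℕ → ℕ
d m n = product (map (λ p → p ^ val p n)
          (filterᵇ (λ p → does (prime? p ×-dec (p ∣? m))) (upTo (suc n))))

-- Write n = q j (from j ∣ n) and let s = u^q be the q-fold repetition of u,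
-- |u| = M = j b^k.  Every position of s is  M c + y  with c < q (the copy)
-- and y < M (the position inside u), and since s is M-periodic, a word w
-- occurs in s at M c + y iff it occurs in u at y.  If f enumerates the j
-- occurrences of w in u, then  (c , x) ↦ M c + f x  enumerates the q j
-- occurrences of w in s.  These are pairwise incongruent modulo q j:
-- reducing modulo j (j ∣ M) gives back x, since f is injective modulo j;
-- and for equal x, q j ∣ M (c' − c) = j b^k (c' − c) forces q ∣ c' − c as
-- soon as q is coprime to b, hence c = c'.
-- Finally, q = n / j is coprime to b: a prime p dividing b and q would give
-- p^{α_p} ∣ d_{b,n} ∣ j, hence p^{α_p + 1} ∣ q j = n, against the
-- maximality of the exponent α_p.
module Submission where

open import Defs
open import Data.Nat
open import Data.Nat.Properties
open import Data.Nat.DivMod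
open import Data.Nat.Divisibility
open import Data.Nat.Coprimality using (Coprime; coprime-divisor)
open import Data.Nat.Primality
open import Data.Nat.Primality.Factorisation using (factorise)
open import Data.Nat.ListAction using (product)
open import Data.Nat.ListAction.Properties using (∈⇒∣product)
open import Data.Fin using (Fin; toℕ; cast; combine; remQuot; remainder)
  renaming (zero to fzero; suc to fsuc)
open import Data.Fin.Properties
  using (toℕ-injective; toℕ<n; toℕ-fromℕ<; toℕ-cast; toℕ-combine; cast-involutive; combine-surjective; remQuot-combine; nonZeroIndex)
open import Data.List using (List; []; _∷_; _++_; length; lookup; concat; replicate; filterᵇ; upTo)
open import Data.List.Properties using (length-++)
open import Data.List.Relation.Unary.All using (_∷_)
open import Data.List.Membership.Propositional using (_∈_)
open import Data.List.Membership.Propositional.Properties using (∈-filter⁺; ∈-map⁺; ∈-upTo⁺)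
open import Data.Product using (Σ; _×_; _,_; proj₁; proj₂; uncurry)
open import Data.Sum using (_⊎_; inj₁; inj₂)
open import Data.Bool using (T; T?; if_then_else_)
open import Data.Unit using (tt)
open import Data.Empty using (⊥; ⊥-elim)
open import Function using (_∘_; _⇔_; mk⇔; Equivalence)
open import Relation.Nullary using (¬_; Dec; yes; no; does; contradiction)
open import Relation.Nullary.Decidable using (_×-dec_; dec-true)
open import Relation.Binary.PropositionalEquality

module _ {A : Set} where

  repeat : ℕ → List A → List A
  repeat q u = concat (replicate q u)

  length-repeat : ∀ q (u : List A) → length (repeat q u) ≡ q * length u
  length-repeat zero    u = refl
  length-repeat (suc q) u = trans (length-++ u) (cong (length u +_) (length-repeat q u))

  lookup-++ : ∀ (xs ys : List A) (i : Fin (length (xs ++ ys))) →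
    (Σ (Fin (length xs)) λ y → toℕ y ≡ toℕ i × lookup (xs ++ ys) i ≡ lookup xs y) ⊎
    (Σ (Fin (length ys)) λ z → length xs + toℕ z ≡ toℕ i × lookup (xs ++ ys) i ≡ lookup ys z)
  lookup-++ []       ys i        = inj₂ (i , refl , refl)
  lookup-++ (x ∷ xs) ys fzero    = inj₁ (fzero , refl , refl)
  lookup-++ (x ∷ xs) ys (fsuc i) with lookup-++ xs ys i
  ... | inj₁ (y , y≡i , entry) = inj₁ (fsuc y , cong suc y≡i , entry)
  ... | inj₂ (z , z≡i , entry) = inj₂ (z , cong suc z≡i , entry)

  lookup-repeat : ∀ q (u : List A) .{{_ : NonZero (length u)}}
    (i : Fin (length (repeat q u))) (y : Fin (length u)) →
    toℕ i % length u ≡ toℕ y → lookup (repeat q u) i ≡ lookup u y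
  lookup-repeat zero    u () y _
  lookup-repeat (suc q) u i y i≡y with lookup-++ u (repeat q u) i
  ... | inj₁ (y' , y'≡i , entry) = trans entry (cong (lookup u) (toℕ-injective (begin
        toℕ y'                ≡⟨ y'≡i ⟩
        toℕ i                 ≡⟨ m<n⇒m%n≡m (subst (_< length u) y'≡i (toℕ<n y')) ⟨
        toℕ i % length u      ≡⟨ i≡y ⟩
        toℕ y                 ∎)))
    where open ≡-Reasoning
  ... | inj₂ (z , z≡i , entry) = trans entry (lookup-repeat q u z y (begin
        toℕ z % length u                ≡⟨ %-remove-+ˡ (toℕ z) ∣-refl ⟨
        (length u + toℕ z) % length u   ≡⟨ cong (_% length u) z≡i ⟩
        toℕ i % length u                ≡⟨ i≡y ⟩
        toℕ y                           ∎))
    where open ≡-Reasoning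

shift-toℕ : ∀ {L} .{{_ : NonZero L}} (i : Fin L) t → toℕ (shift L i t) ≡ (toℕ i + t) % L
shift-toℕ {suc _} i t = toℕ-fromℕ< _

[m%n+o]%n≡[m+o]%n : ∀ m o n .{{_ : NonZero n}} → (m % n + o) % n ≡ (m + o) % n
[m%n+o]%n≡[m+o]%n m o n = begin
  (m % n + o) % n              ≡⟨ %-distribˡ-+ (m % n) o n ⟩
  (m % n % n + o % n) % n      ≡⟨ cong (λ r → (r + o % n) % n) (m%n%n≡m%n m n) ⟩
  (m % n + o % n) % n          ≡⟨ %-distribˡ-+ m o n ⟨
  (m + o) % n                  ∎
  where open ≡-Reasoning

occursAt-repeat : ∀ {A : Set} (w u : List A) q .{{_ : NonZero (length u)}}
  (i : Fin (length (repeat q u))) (y : Fin (length u)) →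
  toℕ i % length u ≡ toℕ y → OccursAt w (repeat q u) i ⇔ OccursAt w u y
occursAt-repeat w u q i y i≡y =
  mk⇔ (λ occ t → trans (sym (same-entry t)) (occ t)) (λ occ t → trans (same-entry t) (occ t))
  where
  open ≡-Reasoning
  M L : ℕ
  M = length u
  L = length (repeat q u)
  instance
    L≢0 : NonZero L
    L≢0 = nonZeroIndex i
  M∣L : M ∣ L
  M∣L = divides q (length-repeat q u)
  same-entry : ∀ t → lookup (repeat q u) (shift L i (toℕ t)) ≡ lookup u (shift M y (toℕ t))
  same-entry t = lookup-repeat q u (shift L i (toℕ t)) (shift M y (toℕ t)) (begin
    toℕ (shift L i (toℕ t)) % M  ≡⟨ cong (_% M) (shift-toℕ i (toℕ t)) ⟩
    (toℕ i + toℕ t) % L % M      ≡⟨ m∣n⇒o%n%m≡o%m M L _ M∣L ⟩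
    (toℕ i + toℕ t) % M          ≡⟨ [m%n+o]%n≡[m+o]%n (toℕ i) (toℕ t) M ⟨
    (toℕ i % M + toℕ t) % M      ≡⟨ cong (λ r → (r + toℕ t) % M) i≡y ⟩
    (toℕ y + toℕ t) % M          ≡⟨ shift-toℕ y (toℕ t) ⟨
    toℕ (shift M y (toℕ t))      ∎)

%-≡⇒∣∸ : ∀ x y n .{{_ : NonZero n}} → x % n ≡ y % n → n ∣ y ∸ x
%-≡⇒∣∸ x y n x≡y = divides (y / n ∸ x / n) (begin
  y ∸ x                                       ≡⟨ cong₂ _∸_ (m≡m%n+[m/n]*n y n) (m≡m%n+[m/n]*n x n) ⟩
  (y % n + y / n * n) ∸ (x % n + x / n * n)   ≡⟨ cong (λ r → (y % n + y / n * n) ∸ (r + x / n * n)) x≡y ⟩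
  (y % n + y / n * n) ∸ (y % n + x / n * n)   ≡⟨ [m+n]∸[m+o]≡n∸o (y % n) _ _ ⟩
  y / n * n ∸ x / n * n                       ≡⟨ *-distribʳ-∸ n (y / n) (x / n) ⟨
  (y / n ∸ x / n) * n                         ∎)
  where open ≡-Reasoning

∣∧<⇒≡0 : ∀ {q e} → q ∣ e → e < q → e ≡ 0
∣∧<⇒≡0 {e = zero}  _   _   = refl
∣∧<⇒≡0 {e = suc _} q∣e e<q = contradiction q∣e (>⇒∤ e<q)

copies-incongruent-≤ : ∀ {q j t M} .{{_ : NonZero (q * j)}} → M ≡ j * t → Coprime q t →
  ∀ v {c c'} → c ≤ c' → c' < q → (M * c + v) % (q * j) ≡ (M * c' + v) % (q * j) → c ≡ c'
copies-incongruent-≤ {q} {j} {t} {M} M≡jt q⊥t v {c} {c'} c≤c' c'<q c≡c' =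
  ≤-antisym c≤c' (m∸n≡0⇒m≤n (∣∧<⇒≡0 q∣c'∸c (≤-<-trans (m∸n≤m c' c) c'<q)))
  where
  open ≡-Reasoning
  instance
    j≢0 : NonZero j
    j≢0 = m*n≢0⇒n≢0 q
  difference : (M * c' + v) ∸ (M * c + v) ≡ j * (t * (c' ∸ c))
  difference = begin
    (M * c' + v) ∸ (M * c + v)   ≡⟨ cong₂ _∸_ (+-comm (M * c') v) (+-comm (M * c) v) ⟩
    (v + M * c') ∸ (v + M * c)   ≡⟨ [m+n]∸[m+o]≡n∸o v (M * c') (M * c) ⟩
    M * c' ∸ M * c               ≡⟨ *-distribˡ-∸ M c' c ⟨
    M * (c' ∸ c)                 ≡⟨ cong (_* (c' ∸ c)) M≡jt ⟩
    j * t * (c' ∸ c)             ≡⟨ *-assoc j t (c' ∸ c) ⟩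
    j * (t * (c' ∸ c))           ∎
  q∣c'∸c : q ∣ c' ∸ c
  q∣c'∸c = coprime-divisor q⊥t (*-cancelˡ-∣ j (subst₂ _∣_ (*-comm q j) difference
             (%-≡⇒∣∸ (M * c + v) (M * c' + v) (q * j) c≡c')))

copies-incongruent : ∀ {q j t M} .{{_ : NonZero (q * j)}} → M ≡ j * t → Coprime q t →
  ∀ v (c c' : Fin q) → (M * toℕ c + v) % (q * j) ≡ (M * toℕ c' + v) % (q * j) → c ≡ c'
copies-incongruent M≡jt q⊥t v c c' c≡c' with ≤-total (toℕ c) (toℕ c')
... | inj₁ c≤c' = toℕ-injective (copies-incongruent-≤ M≡jt q⊥t v c≤c' (toℕ<n c') c≡c')
... | inj₂ c'≤c = toℕ-injective (sym (copies-incongruent-≤ M≡jt q⊥t v c'≤c (toℕ<n c) (sym c≡c')))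

Enumerates : (n : ℕ) .{{_ : NonZero n}} {L : ℕ} → (Fin L → Set) → (Fin n → Fin L) → Set
Enumerates n P f =
  ((a : Fin n) → P (f a)) ×
  ((i : Fin _) → P i → Σ (Fin n) λ a → f a ≡ i) ×
  ((a a' : Fin n) → toℕ (f a) % n ≡ toℕ (f a') % n → a ≡ a')

module Repetition {A : Set} (u w : List A) {j q t : ℕ} .{{_ : NonZero j}} .{{_ : NonZero (q * j)}}
  (length-u : length u ≡ j * t) (q⊥t : Coprime q t) where

  s : List A
  s = repeat q u

  M L : ℕ
  M = length u
  L = length s

  pos : Fin q → Fin M → Fin L
  pos c y = cast (sym (length-repeat q u)) (combine c y)

  toℕ-pos : ∀ c y → toℕ (pos c y) ≡ M * toℕ c + toℕ y
  toℕ-pos c y = trans (toℕ-cast _ (combine c y)) (toℕ-combine c y)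

  pos-surjective : (i : Fin L) → Σ (Fin q) λ c → Σ (Fin M) λ y → pos c y ≡ i
  pos-surjective i with combine-surjective {q} {M} (cast (length-repeat q u) i)
  ... | c , y , combine≡i = c , y , trans (cong (cast (sym (length-repeat q u))) combine≡i)
      (cast-involutive (sym (length-repeat q u)) (length-repeat q u) i)

  occursAt-pos : ∀ c y → OccursAt w s (pos c y) ⇔ OccursAt w u y
  occursAt-pos c y = occursAt-repeat w u q (pos c y) y (begin
    toℕ (pos c y) % M          ≡⟨ cong (_% M) (toℕ-pos c y) ⟩
    (M * toℕ c + toℕ y) % M    ≡⟨ %-remove-+ˡ (toℕ y) {M} (m∣m*n (toℕ c)) ⟩
    toℕ y % M                  ≡⟨ m<n⇒m%n≡m (toℕ<n y) ⟩
    toℕ y                      ∎)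
    where
    open ≡-Reasoning
    instance
      M≢0 : NonZero M
      M≢0 = nonZeroIndex y

  module _ (f : Fin j → Fin M) (enum-u : Enumerates j (OccursAt w u) f) where

    occurs-u : ∀ x → OccursAt w u (f x)
    occurs-u = proj₁ enum-u
    complete-u : ∀ y → OccursAt w u y → Σ (Fin j) λ x → f x ≡ y
    complete-u = proj₁ (proj₂ enum-u)
    injective-u : ∀ x x' → toℕ (f x) % j ≡ toℕ (f x') % j → x ≡ x'
    injective-u = proj₂ (proj₂ enum-u)

    block : Fin q → Fin j → Fin L
    block c x = pos c (f x)

    F : Fin (q * j) → Fin L
    F = uncurry block ∘ remQuot j

    F-combine : ∀ c x → F (combine c x) ≡ block c x
    F-combine c x = cong (uncurry block) (remQuot-combine c x)

    -- Reducing modulo j recovers the residue of f x, because j ∣ M.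
    block-mod-j : ∀ c x → toℕ (block c x) % (q * j) % j ≡ toℕ (f x) % j
    block-mod-j c x = begin
      toℕ (block c x) % (q * j) % j    ≡⟨ m∣n⇒o%n%m≡o%m j (q * j) _ (n∣m*n q) ⟩
      toℕ (block c x) % j              ≡⟨ cong (_% j) (toℕ-pos c (f x)) ⟩
      (M * toℕ c + toℕ (f x)) % j      ≡⟨ %-remove-+ˡ (toℕ (f x)) j∣Mc ⟩
      toℕ (f x) % j                    ∎
      where
      open ≡-Reasoning
      j∣Mc : j ∣ M * toℕ c
      j∣Mc = ∣m⇒∣m*n (toℕ c) (divides t (trans length-u (*-comm j t)))

    block-incongruentʳ : ∀ c x c' x' → toℕ (block c x) % (q * j) ≡ toℕ (block c' x') % (q * j) → x ≡ x'
    block-incongruentʳ c x c' x' block≡ = injective-u x x'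
      (trans (sym (block-mod-j c x)) (trans (cong (_% j) block≡) (block-mod-j c' x')))

    block-incongruent : ∀ c x c' x' → toℕ (block c x) % (q * j) ≡ toℕ (block c' x') % (q * j) →
      c ≡ c' × x ≡ x'
    block-incongruent c x c' x' block≡ with refl ← block-incongruentʳ c x c' x' block≡ =
      copies-incongruent length-u q⊥t (toℕ (f x)) c c' (begin
        (M * toℕ c + toℕ (f x)) % (q * j)    ≡⟨ cong (_% (q * j)) (toℕ-pos c (f x)) ⟨
        toℕ (block c x) % (q * j)            ≡⟨ block≡ ⟩
        toℕ (block c' x) % (q * j)           ≡⟨ cong (_% (q * j)) (toℕ-pos c' (f x)) ⟩
        (M * toℕ c' + toℕ (f x)) % (q * j)   ∎) , refl
      where open ≡-Reasoning

    enumeration : Enumerates (q * j) (OccursAt w s) F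
    enumeration = occurs , complete , injective
      where
      occurs : ∀ a → OccursAt w s (F a)
      occurs a = Equivalence.from (occursAt-pos _ (f (remainder {q} j a))) (occurs-u (remainder {q} j a))

      complete : ∀ i → OccursAt w s i → Σ (Fin (q * j)) λ a → F a ≡ i
      complete i occ with pos-surjective i
      ... | c , y , refl with complete-u y (Equivalence.to (occursAt-pos c y) occ)
      ... | x , refl = combine c x , F-combine c x

      injective : ∀ a a' → toℕ (F a) % (q * j) ≡ toℕ (F a') % (q * j) → a ≡ a'
      injective a a' F≡ with combine-surjective {q} {j} a | combine-surjective {q} {j} a'
      ... | c , x , refl | c' , x' , refl with block-incongruent c x c' x'
                (subst₂ (λ y y' → toℕ y % (q * j) ≡ toℕ y' % (q * j)) (F-combine c x) (F-combine c' x') F≡)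
      ... | refl , refl = refl

coprime-*ʳ : ∀ {m n o} → Coprime m n → Coprime m o → Coprime m (n * o)
coprime-*ʳ {m} {n} m⊥n m⊥o {g} (g∣m , g∣n*o) = m⊥o (g∣m , coprime-divisor g⊥n g∣n*o)
  where
  g⊥n : Coprime g n
  g⊥n (h∣g , h∣n) = m⊥n (∣-trans h∣g g∣m , h∣n)

coprime-^ : ∀ {m n} k → Coprime m n → Coprime m (n ^ k)
coprime-^ zero    m⊥n (_ , g∣1) = ∣1⇒≡1 g∣1
coprime-^ (suc k) m⊥n = coprime-*ʳ m⊥n (coprime-^ k m⊥n)

no-common-prime⇒coprime : ∀ {m n} .{{_ : NonZero m}} →
  (∀ {p} → Prime p → p ∣ m → p ∣ n → ⊥) → Coprime m n
no-common-prime⇒coprime {m} no-common {zero} (0∣m , _) = contradiction (0∣⇒≡0 0∣m) (≢-nonZero⁻¹ m)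
no-common-prime⇒coprime no-common {1} _ = refl
no-common-prime⇒coprime no-common {g@(suc (suc _))} (g∣m , g∣n) with factorise g
... | record { factors = [] ; isFactorisation = () }
... | record { factors = p ∷ ps ; isFactorisation = g≡∏ ; factorsPrime = prime-p ∷ _ } =
  ⊥-elim (no-common prime-p (∣-trans p∣g g∣m) (∣-trans p∣g g∣n))
  where
  p∣g : p ∣ g
  p∣g = subst (p ∣_) (sym g≡∏) (m∣m*n (product ps))

valFuel-maximal : ∀ f p m .{{_ : NonTrivial p}} .{{_ : NonZero m}} → m ≤ f →
  ¬ p ^ suc (valFuel f p m) ∣ m
valFuel-maximal zero    p       (suc _) ()
valFuel-maximal (suc f) p@(suc _) m@(suc _) m≤f = by-cases (p ∣? m)
  where
  instance
    p≢0 : NonZero p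
    p≢0 = nonTrivial⇒nonZero p
  by-cases : (p∣?m : Dec (p ∣ m)) → ¬ p ^ suc (if does p∣?m then suc (valFuel f p (m / p)) else 0) ∣ m
  by-cases (no  p∤m) p¹∣m = p∤m (∣-trans (m∣m*n 1) p¹∣m)
  by-cases (yes p∣m) pᵅ⁺²∣m = valFuel-maximal f p (m / p) m/p≤f
    (*-cancelˡ-∣ p (subst (p * p ^ suc (valFuel f p (m / p)) ∣_) (sym (m*[n/m]≡n p∣m)) pᵅ⁺²∣m))
    where
    instance
      m/p≢0 : NonZero (m / p)
      m/p≢0 = subst NonZero (sym (n/m≡quotient p∣m)) (quotient≢0 p∣m)
    m/p≤f : m / p ≤ f
    m/p≤f = s≤s⁻¹ (≤-trans (m/n<m m p (nonTrivial⇒n>1 p)) m≤f)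

prime-power∣d : ∀ {p m n} → Prime p → p ∣ m → p ≤ n → p ^ val p n ∣ d m n
prime-power∣d {p} {m} {n} prime-p p∣m p≤n = ∈⇒∣product (∈-map⁺ (λ r → r ^ val r n) p∈primes)
  where
  selected : T (does (prime? p ×-dec (p ∣? m)))
  selected = subst T (sym (dec-true (prime? p ×-dec (p ∣? m)) (prime-p , p∣m))) tt
  p∈primes : p ∈ filterᵇ (λ r → does (prime? r ×-dec (r ∣? m))) (upTo (suc n))
  p∈primes = ∈-filter⁺ (λ r → T? (does (prime? r ×-dec (r ∣? m)))) (∈-upTo⁺ (s≤s p≤n)) selected

-- If d_{b,qj} ∣ j then q is coprime to b: a common prime p would satisfy
-- p^{α_p} ∣ j and p ∣ q, hence p^{α_p+1} ∣ q j, against maximality of α_p.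
quotient-coprime : ∀ {b j q} .{{_ : NonZero (q * j)}} → d b (q * j) ∣ j → Coprime q b
quotient-coprime {b} {j} {q} d∣j = no-common-prime⇒coprime {{m*n≢0⇒m≢0 q}} no-common
  where
  no-common : ∀ {p} → Prime p → p ∣ q → p ∣ b → ⊥
  no-common {p} prime-p p∣q p∣b = valFuel-maximal (q * j) p (q * j) {{prime⇒nonTrivial prime-p}} ≤-refl
    (*-pres-∣ p∣q (∣-trans (prime-power∣d prime-p p∣b p≤qj) d∣j))
    where
    p≤qj : p ≤ q * j
    p≤qj = ≤-trans (∣⇒≤ {{m*n≢0⇒m≢0 q}} p∣q) (m≤m*n q j {{m*n≢0⇒n≢0 q}})

repeat-perfect : ∀ {b k j q} .{{_ : NonZero j}} .{{_ : NonZero (q * j)}} (u : List (Fin b)) →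
  Perfect b k j u → Coprime q b → Perfect b k (q * j) (repeat q u)
repeat-perfect {b} {k} {j} {q} u (length-u , enum-u) q⊥b = length-uᵠ , enum-uᵠ
  where
  length-uᵠ : length (repeat q u) ≡ q * j * b ^ k
  length-uᵠ = trans (length-repeat q u) (trans (cong (q *_) length-u) (sym (*-assoc q j (b ^ k))))
  enum-uᵠ : (w : List (Fin b)) → length w ≡ k →
    Σ (Fin (q * j) → Fin (length (repeat q u))) (Enumerates (q * j) (OccursAt w (repeat q u)))
  enum-uᵠ w |w|≡k with enum-u w |w|≡k
  ... | f , enum-w = Repetition.F u w {q = q} length-u (coprime-^ k q⊥b) f enum-w
                   , Repetition.enumeration u w {q = q} length-u (coprime-^ k q⊥b) f enum-w

-- Proposition 3.6: match j ∣ n as n = q j, so that n / j = q.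
proposition3p6 : (b k j n : ℕ) → 1 ≤ k → .{{_ : NonZero j}} → .{{_ : NonZero n}} →
    (u : List (Fin b)) → Perfect b k j u →
    d b n ∣ j → j ∣ n →
    Perfect b k n (concat (replicate (n / j) u))
proposition3p6 b k j .(q * j) _ u perfect-u d∣j (divides q refl) =
  subst (λ r → Perfect b k (q * j) (repeat r u)) (sym (m*n/n≡m q j))
    (repeat-perfect {q = q} u perfect-u (quotient-coprime {q = q} d∣j))
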